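{- Let $I,J$ be maximum feasible sets for $A$ with $I\setminus J=\{u\}$ and $J\setminus I=\{v\}$. Then $a_u,a_v\in P_j$ for some $0\le j\le k$.
   Context: Let $a_1,\dots,a_n$ be distinct integers between $1$ and $n$, and set $a_0=0$, so $A=(a_i)_{i=0,1,\dots,n}$. A set $I\subseteq\{0\}\cup[n]$ is feasible if $a_i<a_j$ for all $i,j\in I$ with $i<j$; a maximum feasible set is a feasible set of maximum cardinality. Patience sorting: start with empty piles $P_0,P_1,\dots,P_n$; for $i=0,1,\dots,n$ in this order, put $a_i$ on the top of the leftmost (smallest-index) pile $P_j$ that is empty or whose current top element is greater than $a_i$. Let $P_0,\dots,P_k$ be the resulting nonempty piles. -}

module Defs where

open import Data.Nat using (ℕ; zero; suc; _<_; _≤_; _<ᵇ_)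
open import Data.Bool using (if_then_else_)
open import Data.Fin using (Fin; zero; suc) renaming (_<_ to _<ᶠ_)
open import Data.Fin.Subset using (Subset; _∈_; ∣_∣)
open import Data.List using (List; []; _∷_; foldl; map)
open import Data.Vec using (toList; allFin)

Feasible : {n : ℕ} → (Fin (suc n) → ℕ) → Subset (suc n) → Set
Feasible a I = ∀ i j → i ∈ I → j ∈ I → i <ᶠ j → a i < a j

MaxFeasible : {n : ℕ} → (Fin (suc n) → ℕ) → Subset (suc n) → Set
MaxFeasible {n} a I = Feasible a I × (∀ (K : Subset (suc n)) → Feasible a K → ∣ K ∣ ≤ ∣ I ∣)
  where open import Data.Product using (_×_)

-- A pile is a list with its top element at the head.
-- The list of piles is ordered P_0, P_1, ... (only nonempty piles are stored;
-- the leftmost empty pile is the one appended at the end).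
place : ℕ → List (List ℕ) → List (List ℕ)
place x [] = (x ∷ []) ∷ []
place x ([] ∷ ps) = (x ∷ []) ∷ ps
place x ((t ∷ p) ∷ ps) =
  if x <ᵇ t then (x ∷ t ∷ p) ∷ ps else (t ∷ p) ∷ place x ps

patience : List ℕ → List (List ℕ)
patience = foldl (λ ps x → place x ps) []

piles : {n : ℕ} → (Fin (suc n) → ℕ) → List (List ℕ)
piles {n} a = patience (map a (toList (allFin (suc n))))

{-# OPTIONS --safe #-}
-- Write pile x for the index of the pile that receives a_x. If a_i < a_j with i < j then
-- pile i < pile j, and each a_x on pile t + 1 has a smaller, earlier element on pile t.
-- Hence for every maximum feasible set K containing x, pile x = |K ∩ [0, x)|: "≥" since K
-- is increasing, "≤" because otherwise the chain ending at x followed by the part of K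
-- after x would beat K. Now let u < v (the other case is symmetric). An element k of J in
-- (u, v) would also lie in I, with |I ∩ [0, k)| = |J ∩ [0, k)| + 1, yet both equal pile k.
-- So J misses [u, v), and pile u = |I ∩ [0, u)| = |J ∩ [0, u)| = |J ∩ [0, v)| = pile v.
module Submission where

open import Defs
open import Data.Bool using (Bool; true; false; if_then_else_)
open import Data.Empty using (⊥; ⊥-elim)
open import Data.Fin using (Fin; zero; suc; toℕ)
open import Data.Fin.Properties using (toℕ<n)
open import Data.Fin.Subset using (Subset; _∈_; _∉_; ∣_∣)
open import Data.List using (List; []; _∷_; _∷ʳ_; applyUpTo; map)
open import Data.List.Membership.Propositional using () renaming (_∈_ to _∈ₗ_)
open import Data.List.Properties using (applyUpTo-∷ʳ; foldl-∷ʳ)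
open import Data.List.Relation.Unary.Any using (here; there)
open import Data.Nat
open import Data.Nat.Properties
open import Data.Product using (_×_; _,_; proj₁; proj₂; ∃; ∃₂; ∃-syntax)
open import Data.Sum using (_⊎_; inj₁; inj₂)
open import Data.Unit using (⊤; tt)
open import Data.Vec using ([]; _∷_; lookup; tabulate; toList)
open import Data.Vec.Properties using (lookup∘tabulate; []=⇒lookup; lookup⇒[]=)
open import Function.Base using (_∘_)
open import Function.Bundles using (_⇔_; Equivalence)
open import Function.Definitions using (Injective)
open import Relation.Binary.Definitions using (tri<; tri≈; tri>)
open import Relation.Binary.PropositionalEquality
open import Relation.Nullary using (yes; no)
open import Relation.Nullary.Reflects using (ofʸ; ofⁿ)

_!_ : List (List ℕ) → ℕ → List ℕ
[] ! q = []
(p ∷ ps) ! zero = p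
(p ∷ ps) ! suc q = ps ! q

slot : ℕ → List (List ℕ) → ℕ
slot x [] = 0
slot x ([] ∷ ps) = 0
slot x ((t ∷ p) ∷ ps) = if x <ᵇ t then 0 else suc (slot x ps)

place-!-slot : ∀ x ps → ∃ λ p → place x ps ! slot x ps ≡ x ∷ p
place-!-slot x [] = _ , refl
place-!-slot x ([] ∷ ps) = _ , refl
place-!-slot x ((t ∷ p) ∷ ps) with x <ᵇ t
... | true = _ , refl
... | false = place-!-slot x ps

∈-place⁺ : ∀ x ps q {y} → y ∈ₗ ps ! q → y ∈ₗ place x ps ! q
∈-place⁺ x [] q ()
∈-place⁺ x ([] ∷ ps) zero ()
∈-place⁺ x ([] ∷ ps) (suc q) y∈ = y∈
∈-place⁺ x ((t ∷ p) ∷ ps) q y∈ with x <ᵇ t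
∈-place⁺ x ((t ∷ p) ∷ ps) zero y∈ | true = there y∈
∈-place⁺ x ((t ∷ p) ∷ ps) (suc q) y∈ | true = y∈
∈-place⁺ x ((t ∷ p) ∷ ps) zero y∈ | false = y∈
∈-place⁺ x ((t ∷ p) ∷ ps) (suc q) y∈ | false = ∈-place⁺ x ps q y∈

∈-place⁻ : ∀ x ps q {y} → y ∈ₗ place x ps ! q → (y ≡ x × q ≡ slot x ps) ⊎ y ∈ₗ ps ! q
∈-place⁻ x [] zero (here y≡x) = inj₁ (y≡x , refl)
∈-place⁻ x [] (suc zero) ()
∈-place⁻ x [] (suc (suc q)) ()
∈-place⁻ x ([] ∷ ps) zero (here y≡x) = inj₁ (y≡x , refl)
∈-place⁻ x ([] ∷ ps) (suc q) y∈ = inj₂ y∈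
∈-place⁻ x ((t ∷ p) ∷ ps) q y∈ with x <ᵇ t
∈-place⁻ x ((t ∷ p) ∷ ps) zero (here y≡x) | true = inj₁ (y≡x , refl)
∈-place⁻ x ((t ∷ p) ∷ ps) zero (there y∈) | true = inj₂ y∈
∈-place⁻ x ((t ∷ p) ∷ ps) (suc q) y∈ | true = inj₂ y∈
∈-place⁻ x ((t ∷ p) ∷ ps) zero y∈ | false = inj₂ y∈
∈-place⁻ x ((t ∷ p) ∷ ps) (suc q) y∈ | false with ∈-place⁻ x ps q y∈
... | inj₁ (y≡x , q≡slot) = inj₁ (y≡x , cong suc q≡slot)
... | inj₂ y∈′ = inj₂ y∈′

place-top-≤ : ∀ x ps q {t p} → ps ! q ≡ t ∷ p → ∃₂ λ t′ p′ → place x ps ! q ≡ t′ ∷ p′ × t′ ≤ t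
place-top-≤ x [] q ()
place-top-≤ x ([] ∷ ps) zero ()
place-top-≤ x ([] ∷ ps) (suc q) eq = _ , _ , eq , ≤-refl
place-top-≤ x ((t ∷ p) ∷ ps) q eq with x <ᵇ t | <ᵇ-reflects-< x t
place-top-≤ x ((t ∷ p) ∷ ps) zero refl | true | ofʸ x<t = _ , _ , refl , <⇒≤ x<t
place-top-≤ x ((t ∷ p) ∷ ps) (suc q) eq | true | _ = _ , _ , eq , ≤-refl
place-top-≤ x ((t ∷ p) ∷ ps) zero eq | false | _ = _ , _ , eq , ≤-refl
place-top-≤ x ((t ∷ p) ∷ ps) (suc q) eq | false | _ = place-top-≤ x ps q eq

AscendingTops : ℕ → List (List ℕ) → Set
AscendingTops lo [] = ⊤
AscendingTops lo ([] ∷ ps) = ⊥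
AscendingTops lo ((t ∷ p) ∷ ps) = lo ≤ t × AscendingTops t ps

ascendingTops-weaken : ∀ {lo lo′} ps → lo′ ≤ lo → AscendingTops lo ps → AscendingTops lo′ ps
ascendingTops-weaken [] _ _ = tt
ascendingTops-weaken ((t ∷ p) ∷ ps) lo′≤lo (lo≤t , asc) = ≤-trans lo′≤lo lo≤t , asc

place-ascendingTops : ∀ {lo} x ps → lo ≤ x → AscendingTops lo ps → AscendingTops lo (place x ps)
place-ascendingTops x [] lo≤x _ = lo≤x , tt
place-ascendingTops x ((t ∷ p) ∷ ps) lo≤x (lo≤t , asc) with x <ᵇ t | <ᵇ-reflects-< x t
... | true | ofʸ x<t = lo≤x , ascendingTops-weaken ps (<⇒≤ x<t) asc
... | false | ofⁿ x≮t = lo≤t , place-ascendingTops x ps (≮⇒≥ x≮t) asc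

ascendingTops-≤-top : ∀ {lo} ps q {t p} → AscendingTops lo ps → ps ! q ≡ t ∷ p → lo ≤ t
ascendingTops-≤-top ((t ∷ p) ∷ ps) zero (lo≤t , _) refl = lo≤t
ascendingTops-≤-top ((t ∷ p) ∷ ps) (suc q) (lo≤t , asc) eq = ≤-trans lo≤t (ascendingTops-≤-top ps q asc eq)

slot-beyond-smaller-top : ∀ {lo} x ps q {t p} → AscendingTops lo ps → ps ! q ≡ t ∷ p → t < x → q < slot x ps
slot-beyond-smaller-top x ((t₀ ∷ p₀) ∷ ps) q (_ , asc) eq t<x with x <ᵇ t₀ | <ᵇ-reflects-< x t₀
slot-beyond-smaller-top x ((t₀ ∷ p₀) ∷ ps) zero _ refl t<x | true | ofʸ x<t₀ = ⊥-elim (<-asym t<x x<t₀)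
slot-beyond-smaller-top x ((t₀ ∷ p₀) ∷ ps) (suc q) (_ , asc) eq t<x | true | ofʸ x<t₀ =
  ⊥-elim (<-asym (≤-<-trans (ascendingTops-≤-top ps q asc eq) t<x) x<t₀)
slot-beyond-smaller-top x ((t₀ ∷ p₀) ∷ ps) zero _ _ _ | false | _ = z<s
slot-beyond-smaller-top x ((t₀ ∷ p₀) ∷ ps) (suc q) (_ , asc) eq t<x | false | _ =
  s<s (slot-beyond-smaller-top x ps q asc eq t<x)

slot-suc-top-≤ : ∀ x ps q → slot x ps ≡ suc q → ∃₂ λ t p → ps ! q ≡ t ∷ p × t ≤ x
slot-suc-top-≤ x [] q ()
slot-suc-top-≤ x ([] ∷ ps) q ()
slot-suc-top-≤ x ((t ∷ p) ∷ ps) q eq with x <ᵇ t | <ᵇ-reflects-< x t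
slot-suc-top-≤ x ((t ∷ p) ∷ ps) q () | true | _
slot-suc-top-≤ x ((t ∷ p) ∷ ps) zero eq | false | ofⁿ x≮t = _ , _ , refl , ≮⇒≥ x≮t
slot-suc-top-≤ x ((t ∷ p) ∷ ps) (suc q) eq | false | _ = slot-suc-top-≤ x ps q (suc-injective eq)

!-∈ : ∀ ps q {y} → y ∈ₗ ps ! q → ps ! q ∈ₗ ps
!-∈ (p ∷ ps) zero _ = here refl
!-∈ (p ∷ ps) (suc q) y∈ = there (!-∈ ps q y∈)

count : (ℕ → Bool) → ℕ → ℕ
count S zero = 0
count S (suc m) = if S m then suc (count S m) else count S m

count-true : ∀ S {m} → S m ≡ true → count S (suc m) ≡ suc (count S m)
count-true S S-m rewrite S-m = refl

count-suc-≥ : ∀ S m → count S m ≤ count S (suc m)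
count-suc-≥ S m with S m
... | true = n≤1+n _
... | false = ≤-refl

count-mono : ∀ S {m m′} → m ≤ m′ → count S m ≤ count S m′
count-mono S {m′ = zero} z≤n = ≤-refl
count-mono S {m′ = suc m′} m≤1+m′ with m≤n⇒m<n∨m≡n m≤1+m′
... | inj₂ refl = ≤-refl
... | inj₁ m<1+m′ = ≤-trans (count-mono S (s≤s⁻¹ m<1+m′)) (count-suc-≥ S m′)

count-⊆ : ∀ S T → (∀ {k} → S k ≡ true → T k ≡ true) → ∀ m → count S m ≤ count T m
count-⊆ S T S⊆T zero = z≤n
count-⊆ S T S⊆T (suc m) with S m in S-m
... | true rewrite S⊆T S-m = s≤s (count-⊆ S T S⊆T m)
... | false with T m
...   | true = m≤n⇒m≤1+n (count-⊆ S T S⊆T m)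
...   | false = count-⊆ S T S⊆T m

-- Stated with both sides moved so that no subtraction occurs.
count-agree-between : ∀ S T {m M} → (∀ {k} → m ≤ k → k < M → S k ≡ T k) → m ≤ M →
                      count S M + count T m ≡ count T M + count S m
count-agree-between S T {M = zero} _ z≤n = refl
count-agree-between S T {m} {suc M} agree m≤1+M with m≤n⇒m<n∨m≡n m≤1+M
... | inj₂ refl = +-comm (count S (suc M)) (count T (suc M))
... | inj₁ m<1+M rewrite agree (s≤s⁻¹ m<1+M) (n<1+n M) with T M
...   | true = cong suc (count-agree-between S T (λ m≤k k<M → agree m≤k (m<n⇒m<1+n k<M)) (s≤s⁻¹ m<1+M))
...   | false = count-agree-between S T (λ m≤k k<M → agree m≤k (m<n⇒m<1+n k<M)) (s≤s⁻¹ m<1+M)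

count-agree-below : ∀ S T m → (∀ {k} → k < m → S k ≡ T k) → count S m ≡ count T m
count-agree-below S T m agree =
  +-cancelʳ-≡ 0 (count S m) (count T m) (count-agree-between S T (λ _ → agree) z≤n)

count-false-between : ∀ S {m M} → (∀ {k} → m ≤ k → k < M → S k ≡ false) → m ≤ M → count S M ≡ count S m
count-false-between S {M = zero} _ z≤n = refl
count-false-between S {m} {suc M} S-false m≤1+M with m≤n⇒m<n∨m≡n m≤1+M
... | inj₂ refl = refl
... | inj₁ m<1+M rewrite S-false (s≤s⁻¹ m<1+M) (n<1+n M) =
  count-false-between S (λ m≤k k<M → S-false m≤k (m<n⇒m<1+n k<M)) (s≤s⁻¹ m<1+M)

count-differ-at : ∀ S T u m → (∀ {k} → k < m → k ≢ u → S k ≡ T k) → u < m → S u ≡ true → T u ≡ false →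
                  count S m ≡ suc (count T m)
count-differ-at S T u (suc m) agree u<1+m S-u T-u with m≤n⇒m<n∨m≡n (s≤s⁻¹ u<1+m)
... | inj₂ refl rewrite S-u | T-u =
  cong suc (count-agree-below S T u (λ k<u → agree (m<n⇒m<1+n k<u) (<⇒≢ k<u)))
... | inj₁ u<m rewrite agree (n<1+n m) (≢-sym (<⇒≢ u<m)) with T m
...   | true = cong suc (count-differ-at S T u m (λ k<m → agree (m<n⇒m<1+n k<m)) u<m S-u T-u)
...   | false = count-differ-at S T u m (λ k<m → agree (m<n⇒m<1+n k<m)) u<m S-u T-u

count-split-first : ∀ S m → count S (suc m) ≡ count S 1 + count (λ k → S (suc k)) m
count-split-first S zero = sym (+-identityʳ (count S 1))
count-split-first S (suc m) with S (suc m)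
... | true = trans (cong suc (count-split-first S m)) (sym (+-suc (count S 1) _))
... | false = count-split-first S m

-- Patience sorting of an ℕ-indexed sequence

module Patience (b : ℕ → ℕ) where

  state : ℕ → List (List ℕ)
  state zero = []
  state (suc m) = place (b m) (state m)

  pile : ℕ → ℕ
  pile i = slot (b i) (state i)

  patience-applyUpTo : ∀ m → patience (applyUpTo b m) ≡ state m
  patience-applyUpTo zero = refl
  patience-applyUpTo (suc m) = begin
    patience (applyUpTo b (suc m))                  ≡⟨ cong patience (applyUpTo-∷ʳ b m) ⟨
    patience (applyUpTo b m ∷ʳ b m)                 ≡⟨ foldl-∷ʳ (λ ps x → place x ps) [] (b m) (applyUpTo b m) ⟩
    place (b m) (patience (applyUpTo b m))          ≡⟨ cong (place (b m)) (patience-applyUpTo m) ⟩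
    state (suc m)                                   ∎
    where open ≡-Reasoning

  state-ascendingTops : ∀ m → AscendingTops 0 (state m)
  state-ascendingTops zero = tt
  state-ascendingTops (suc m) = place-ascendingTops (b m) (state m) z≤n (state-ascendingTops m)

  ∈-state-mono : ∀ {i j q y} → i ≤ j → y ∈ₗ state i ! q → y ∈ₗ state j ! q
  ∈-state-mono {j = zero} z≤n y∈ = y∈
  ∈-state-mono {j = suc j} {q} i≤1+j y∈ with m≤n⇒m<n∨m≡n i≤1+j
  ... | inj₂ refl = y∈
  ... | inj₁ i<1+j = ∈-place⁺ (b j) (state j) q (∈-state-mono (s≤s⁻¹ i<1+j) y∈)

  ∈-pile : ∀ i → b i ∈ₗ state (suc i) ! pile i
  ∈-pile i with place-!-slot (b i) (state i)
  ... | _ , eq rewrite eq = here refl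

  ∈-state⁻ : ∀ m q {y} → y ∈ₗ state m ! q → ∃ λ i → i < m × b i ≡ y × pile i ≡ q
  ∈-state⁻ zero zero ()
  ∈-state⁻ zero (suc q) ()
  ∈-state⁻ (suc m) q y∈ with ∈-place⁻ (b m) (state m) q y∈
  ... | inj₁ (y≡bm , q≡pile) = m , n<1+n m , sym y≡bm , sym q≡pile
  ... | inj₂ y∈′ with ∈-state⁻ m q y∈′
  ...   | i , i<m , bi≡y , pile≡q = i , m<n⇒m<1+n i<m , bi≡y , pile≡q

  pile-top-≤ : ∀ {i j} → i < j → ∃₂ λ t p → state j ! pile i ≡ t ∷ p × t ≤ b i
  pile-top-≤ {i} {suc j} i<1+j with m≤n⇒m<n∨m≡n (s≤s⁻¹ i<1+j)
  ... | inj₂ refl = b i , _ , proj₂ (place-!-slot (b i) (state i)) , ≤-refl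
  ... | inj₁ i<j with pile-top-≤ i<j
  ...   | t , p , eq , t≤bi with place-top-≤ (b j) (state j) (pile i) eq
  ...     | t′ , p′ , eq′ , t′≤t = t′ , p′ , eq′ , ≤-trans t′≤t t≤bi

  pile-mono : ∀ {i j} → i < j → b i < b j → pile i < pile j
  pile-mono {i} {j} i<j bi<bj with pile-top-≤ i<j
  ... | t , p , eq , t≤bi =
    slot-beyond-smaller-top (b j) (state j) (pile i) (state-ascendingTops j) eq (≤-<-trans t≤bi bi<bj)

  commonPile-state : ∀ {u v N} → u < N → v < N → pile u ≡ pile v →
                     ∃ λ P → P ∈ₗ state N × b u ∈ₗ P × b v ∈ₗ P
  commonPile-state {u} {v} {N} u<N v<N pu≡pv =
    state N ! pile u , !-∈ (state N) (pile u) bu∈ , bu∈ ,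
    subst (λ q → b v ∈ₗ state N ! q) (sym pu≡pv) (∈-state-mono v<N (∈-pile v))
    where
    bu∈ : b u ∈ₗ state N ! pile u
    bu∈ = ∈-state-mono u<N (∈-pile u)

-- Increasing subsequences and pile indices

insert : ℕ → (ℕ → Bool) → ℕ → Bool
insert x S c with c ≟ x
... | yes _ = true
... | no _ = S c

insert-new : ∀ x S → insert x S x ≡ true
insert-new x S with x ≟ x
... | yes _ = refl
... | no x≢x = ⊥-elim (x≢x refl)

insert-old : ∀ x S {c} → S c ≡ true → insert x S c ≡ true
insert-old x S {c} S-c with c ≟ x
... | yes _ = refl
... | no _ = S-c

insert⁻ : ∀ x S c → insert x S c ≡ true → c ≡ x ⊎ S c ≡ true
insert⁻ x S c ins-c with c ≟ x
... | yes c≡x = inj₁ c≡x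
... | no _ = inj₂ ins-c

count-insert : ∀ x S → suc (count S x) ≤ count (insert x S) (suc x)
count-insert x S = begin
  suc (count S x)              ≤⟨ s≤s (count-⊆ S (insert x S) (insert-old x S) x) ⟩
  suc (count (insert x S) x)   ≡⟨ count-true (insert x S) {x} (insert-new x S) ⟨
  count (insert x S) (suc x)   ∎
  where open ≤-Reasoning

splice : ℕ → (ℕ → Bool) → (ℕ → Bool) → ℕ → Bool
splice x C K c = if c ≤ᵇ x then C c else K c

splice-≤ : ∀ x C K {c} → c ≤ x → splice x C K c ≡ C c
splice-≤ x C K {c} c≤x with c ≤ᵇ x | ≤ᵇ-reflects-≤ c x
... | true | _ = refl
... | false | ofⁿ c≰x = ⊥-elim (c≰x c≤x)

splice-> : ∀ x C K {c} → x < c → splice x C K c ≡ K c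
splice-> x C K {c} x<c with c ≤ᵇ x | ≤ᵇ-reflects-≤ c x
... | true | ofʸ c≤x = ⊥-elim (<⇒≱ x<c c≤x)
... | false | _ = refl

module Subsequences (N : ℕ) (b : ℕ → ℕ) where
  open Patience b

  Increasing : (ℕ → Bool) → Set
  Increasing S = ∀ {i j} → i < N → j < N → S i ≡ true → S j ≡ true → i < j → b i < b j

  Maximum : (ℕ → Bool) → Set
  Maximum S = Increasing S × (∀ T → Increasing T → count T N ≤ count S N)

  record Exchange (I J : ℕ → Bool) (u v : ℕ) : Set where
    field
      u∈I : I u ≡ true
      u∉J : J u ≡ false
      v∈J : J v ≡ true
      v∉I : I v ≡ false
      agree : ∀ {k} → k < N → k ≢ u → k ≢ v → I k ≡ J k

  exchange-sym : ∀ {I J u v} → Exchange I J u v → Exchange J I v u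
  exchange-sym E = record
    { u∈I = v∈J ; u∉J = v∉I ; v∈J = u∈I ; v∉I = u∉J
    ; agree = λ k<N k≢v k≢u → sym (agree k<N k≢u k≢v) }
    where open Exchange E

  Below : ℕ → (ℕ → Bool) → Set
  Below x C = ∀ {c} → C c ≡ true → c ≤ x × b c ≤ b x

  insert-increasing : ∀ {x C} → Increasing C → (∀ {c} → C c ≡ true → c < x × b c < b x) →
                      Increasing (insert x C)
  insert-increasing {x} {C} incr below {i} {j} i<N j<N ins-i ins-j i<j
    with insert⁻ x C i ins-i | insert⁻ x C j ins-j
  ... | inj₁ refl | inj₁ refl = ⊥-elim (<-irrefl refl i<j)
  ... | inj₁ refl | inj₂ C-j = ⊥-elim (<-asym i<j (proj₁ (below C-j)))
  ... | inj₂ C-i | inj₁ refl = proj₂ (below C-i)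
  ... | inj₂ C-i | inj₂ C-j = incr i<N j<N C-i C-j i<j

  insert-below : ∀ {x C} → (∀ {c} → C c ≡ true → c < x × b c < b x) → Below x (insert x C)
  insert-below {x} {C} below {c} ins-c with insert⁻ x C c ins-c
  ... | inj₁ refl = ≤-refl , ≤-refl
  ... | inj₂ C-c = <⇒≤ (proj₁ (below C-c)) , <⇒≤ (proj₂ (below C-c))

  count-≤-pile : ∀ {K x} → Increasing K → x < N → K x ≡ true → count K x ≤ pile x
  count-≤-pile {K} incr = go ≤-refl
    where
    go : ∀ {m x} → m ≤ x → x < N → K x ≡ true → count K m ≤ pile x
    go {zero} _ _ _ = z≤n
    go {suc m} m<x x<N K-x with K m in K-m
    ... | true = ≤-<-trans (go ≤-refl m<N K-m) (pile-mono m<x (incr m<N x<N K-m K-x m<x))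
      where m<N = <-trans m<x x<N
    ... | false = go (<⇒≤ m<x) x<N K-x

  module _ (distinct : ∀ {i j} → i < N → j < N → b i ≡ b j → i ≡ j) where

    pile-predecessor : ∀ {j t} → j < N → pile j ≡ suc t → ∃ λ i → i < j × b i < b j × pile i ≡ t
    pile-predecessor {j} {t} j<N pj≡1+t with slot-suc-top-≤ (b j) (state j) t pj≡1+t
    ... | y , p , eq , y≤bj with ∈-state⁻ j t (subst (y ∈ₗ_) (sym eq) (here refl))
    ...   | i , i<j , refl , pi≡t =
      i , i<j , ≤∧≢⇒< y≤bj (λ bi≡bj → <⇒≢ i<j (distinct (<-trans i<j j<N) j<N bi≡bj)) , pi≡t

    -- Following pile-predecessor down to pile 0 yields an increasing chain of length pile x + 1.
    chain-ending-at : ∀ t {x} → x < N → pile x ≡ t →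
                      ∃ λ C → Increasing C × Below x C × suc t ≤ count C (suc x)
    chain-ending-at zero {x} _ _ =
      insert x (λ _ → false) , insert-increasing (λ _ _ ()) (λ ()) , insert-below (λ ()) ,
      ≤-trans (s≤s z≤n) (count-insert x (λ _ → false))
    chain-ending-at (suc t) {x} x<N px≡1+t with pile-predecessor x<N px≡1+t
    ... | p , p<x , bp<bx , pp≡t with chain-ending-at t (<-trans p<x x<N) pp≡t
    ...   | C , incr , below , len = insert x C , insert-increasing incr below-strict , insert-below below-strict ,
            ≤-trans (s≤s (≤-trans len (count-mono C p<x))) (count-insert x C)
      where
      below-strict : ∀ {c} → C c ≡ true → c < x × b c < b x
      below-strict C-c = ≤-<-trans (proj₁ (below C-c)) p<x , ≤-<-trans (proj₂ (below C-c)) bp<bx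

    pile-≤-count : ∀ {K x} → Maximum K → x < N → K x ≡ true → pile x ≤ count K x
    pile-≤-count {K} {x} (incrK , maxK) x<N K-x with chain-ending-at (pile x) x<N refl
    ... | C , incrC , belowC , lenC = s≤s⁻¹ (+-cancelˡ-≤ (count K N) _ _ (begin
      count K N + suc (pile x)     ≤⟨ +-monoʳ-≤ (count K N) lenC ⟩
      count K N + count C (suc x)  ≡⟨ cong (count K N +_) (count-agree-below S C (suc x) (splice-≤ x C K ∘ s≤s⁻¹)) ⟨
      count K N + count S (suc x)  ≡⟨ count-agree-between S K (λ x<k _ → splice-> x C K x<k) x<N ⟨
      count S N + count K (suc x)  ≤⟨ +-monoˡ-≤ (count K (suc x)) (maxK S incrS) ⟩
      count K N + count K (suc x)  ≡⟨ cong (count K N +_) (count-true K K-x) ⟩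
      count K N + suc (count K x)  ∎))
      where
      open ≤-Reasoning
      S : ℕ → Bool
      S = splice x C K
      C⁺ : ∀ {c} → c ≤ x → S c ≡ true → C c ≡ true
      C⁺ c≤x = trans (sym (splice-≤ x C K c≤x))
      K⁺ : ∀ {c} → x < c → S c ≡ true → K c ≡ true
      K⁺ x<c = trans (sym (splice-> x C K x<c))
      incrS : Increasing S
      incrS {i} {j} i<N j<N S-i S-j i<j with i ≤? x | j ≤? x
      ... | yes i≤x | yes j≤x = incrC i<N j<N (C⁺ i≤x S-i) (C⁺ j≤x S-j) i<j
      ... | yes i≤x | no j≰x =
        ≤-<-trans (proj₂ (belowC (C⁺ i≤x S-i))) (incrK x<N j<N K-x (K⁺ (≰⇒> j≰x) S-j) (≰⇒> j≰x))
      ... | no i≰x | yes j≤x = ⊥-elim (<⇒≱ (<-trans (≰⇒> i≰x) i<j) j≤x)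
      ... | no i≰x | no j≰x = incrK i<N j<N (K⁺ (≰⇒> i≰x) S-i) (K⁺ (≰⇒> j≰x) S-j) i<j

    pile≡count : ∀ {K x} → Maximum K → x < N → K x ≡ true → pile x ≡ count K x
    pile≡count maxK x<N K-x = ≤-antisym (pile-≤-count maxK x<N K-x) (count-≤-pile (proj₁ maxK) x<N K-x)

    exchange-gap : ∀ {I J u v} → Maximum I → Maximum J → Exchange I J u v → v < N →
                   ∀ {k} → u ≤ k → k < v → J k ≡ false
    exchange-gap {I} {J} {u} {v} maxI maxJ E v<N {k} u≤k k<v with m≤n⇒m<n∨m≡n u≤k
    ... | inj₂ refl = Exchange.u∉J E
    ... | inj₁ u<k with J k in J-k
    ...   | false = refl
    ...   | true = ⊥-elim (<⇒≢ (n<1+n (count J k)) (begin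
      count J k        ≡⟨ pile≡count maxJ k<N J-k ⟨
      pile k           ≡⟨ pile≡count maxI k<N I-k ⟩
      count I k        ≡⟨ count-differ-at I J u k agree-below-k u<k u∈I u∉J ⟩
      suc (count J k)  ∎))
      where
      open Exchange E
      open ≡-Reasoning
      k<N : k < N
      k<N = <-trans k<v v<N
      I-k : I k ≡ true
      I-k = trans (agree k<N (≢-sym (<⇒≢ u<k)) (<⇒≢ k<v)) J-k
      agree-below-k : ∀ {i} → i < k → i ≢ u → I i ≡ J i
      agree-below-k i<k i≢u = agree (<-trans i<k k<N) i≢u (<⇒≢ (<-trans i<k k<v))

    exchange-pile≡-< : ∀ {I J u v} → Maximum I → Maximum J → Exchange I J u v → u < v → v < N →
                       pile u ≡ pile v
    exchange-pile≡-< {I} {J} {u} {v} maxI maxJ E u<v v<N = begin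
      pile u     ≡⟨ pile≡count maxI u<N u∈I ⟩
      count I u  ≡⟨ count-agree-below I J u agree-below-u ⟩
      count J u  ≡⟨ count-false-between J (exchange-gap maxI maxJ E v<N) (<⇒≤ u<v) ⟨
      count J v  ≡⟨ pile≡count maxJ v<N v∈J ⟨
      pile v     ∎
      where
      open Exchange E
      open ≡-Reasoning
      u<N : u < N
      u<N = <-trans u<v v<N
      agree-below-u : ∀ {k} → k < u → I k ≡ J k
      agree-below-u k<u = agree (<-trans k<u u<N) (<⇒≢ k<u) (<⇒≢ (<-trans k<u u<v))

    exchange-pile≡ : ∀ {I J u v} → Maximum I → Maximum J → Exchange I J u v → u < N → v < N →
                     pile u ≡ pile v
    exchange-pile≡ {u = u} {v} maxI maxJ E u<N v<N with <-cmp u v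
    ... | tri< u<v _ _ = exchange-pile≡-< maxI maxJ E u<v v<N
    ... | tri≈ _ refl _ with trans (sym (Exchange.u∈I E)) (Exchange.v∉I E)
    ...   | ()
    exchange-pile≡ maxI maxJ E u<N v<N | tri> _ _ v<u =
      sym (exchange-pile≡-< maxJ maxI (exchange-sym E) v<u u<N)

-- From Fin-indexed sequences and subsets to ℕ-indexed ones

clamp : (n : ℕ) → ℕ → Fin (suc n)
clamp n zero = zero
clamp zero (suc k) = zero
clamp (suc n) (suc k) = suc (clamp n k)

clamp-toℕ : ∀ n (i : Fin (suc n)) → clamp n (toℕ i) ≡ i
clamp-toℕ n zero = refl
clamp-toℕ (suc n) (suc i) = cong suc (clamp-toℕ n i)

toℕ-clamp : ∀ n {k} → k < suc n → toℕ (clamp n k) ≡ k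
toℕ-clamp n {zero} _ = refl
toℕ-clamp zero {suc k} (s≤s ())
toℕ-clamp (suc n) {suc k} k<2+n = cong suc (toℕ-clamp n (s≤s⁻¹ k<2+n))

∉⇒lookup≡false : ∀ {m} (P : Subset m) {x} → x ∉ P → lookup P x ≡ false
∉⇒lookup≡false P {x} x∉P with lookup P x in eq
... | true = ⊥-elim (x∉P (lookup⇒[]= x P eq))
... | false = refl

lookup≡false⇒∉ : ∀ {m} (P : Subset m) {x} → lookup P x ≡ false → x ∉ P
lookup≡false⇒∉ P eq x∈P with trans (sym ([]=⇒lookup x∈P)) eq
... | ()

∣∣≡count : ∀ {m} (V : Subset m) (S : ℕ → Bool) → (∀ i → lookup V i ≡ S (toℕ i)) → ∣ V ∣ ≡ count S m
∣∣≡count [] S _ = refl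
∣∣≡count {suc m} (x ∷ V) S V≗S with S 0 | V≗S zero | count-split-first S m
... | true | refl | eq = trans (cong suc (∣∣≡count V (S ∘ suc) (V≗S ∘ suc))) (sym eq)
... | false | refl | eq = trans (∣∣≡count V (S ∘ suc) (V≗S ∘ suc)) (sym eq)

map-toList-tabulate : ∀ {A : Set} m (h : Fin m → A) (g : A → ℕ) (f : ℕ → ℕ) →
                      (∀ i → g (h i) ≡ f (toℕ i)) → map g (toList (tabulate h)) ≡ applyUpTo f m
map-toList-tabulate zero h g f _ = refl
map-toList-tabulate (suc m) h g f g∘h≗f =
  cong₂ _∷_ (g∘h≗f zero) (map-toList-tabulate m (h ∘ suc) g (f ∘ suc) (g∘h≗f ∘ suc))

module OnFin (n : ℕ) (a : Fin (suc n) → ℕ) where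

  -- Indices beyond n are clamped to n; only indices below suc n are ever used.
  b : ℕ → ℕ
  b = a ∘ clamp n

  open Patience b public
  open Subsequences (suc n) b public

  indicator : Subset (suc n) → ℕ → Bool
  indicator K = lookup K ∘ clamp n

  indicator-toℕ : ∀ K i → indicator K (toℕ i) ≡ lookup K i
  indicator-toℕ K i = cong (lookup K) (clamp-toℕ n i)

  distinct : Injective _≡_ _≡_ a → ∀ {i j} → i < suc n → j < suc n → b i ≡ b j → i ≡ j
  distinct a-inj {i} {j} i<N j<N bi≡bj = begin
    i                  ≡⟨ toℕ-clamp n i<N ⟨
    toℕ (clamp n i)    ≡⟨ cong toℕ (a-inj bi≡bj) ⟩
    toℕ (clamp n j)    ≡⟨ toℕ-clamp n j<N ⟩
    j                  ∎
    where open ≡-Reasoning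

  feasible⇒increasing : ∀ {K} → Feasible a K → Increasing (indicator K)
  feasible⇒increasing {K} feasible {i} {j} i<N j<N K-i K-j i<j =
    feasible (clamp n i) (clamp n j) (lookup⇒[]= _ K K-i) (lookup⇒[]= _ K K-j)
      (subst₂ _<_ (sym (toℕ-clamp n i<N)) (sym (toℕ-clamp n j<N)) i<j)

  increasing⇒feasible : ∀ {S} → Increasing S → Feasible a (tabulate (S ∘ toℕ))
  increasing⇒feasible {S} incr i j i∈ j∈ i<j =
    subst₂ _<_ (cong a (clamp-toℕ n i)) (cong a (clamp-toℕ n j))
      (incr (toℕ<n i) (toℕ<n j) (tabulated i∈) (tabulated j∈) i<j)
    where
    tabulated : ∀ {k} → k ∈ tabulate (S ∘ toℕ) → S (toℕ k) ≡ true
    tabulated {k} k∈ = trans (sym (lookup∘tabulate (S ∘ toℕ) k)) ([]=⇒lookup k∈)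

  maxFeasible⇒maximum : ∀ {K} → MaxFeasible a K → Maximum (indicator K)
  maxFeasible⇒maximum {K} (feasible , maximal) = feasible⇒increasing feasible , λ S incr →
    subst₂ _≤_ (∣∣≡count _ S (lookup∘tabulate (S ∘ toℕ))) (∣∣≡count K (indicator K) (sym ∘ indicator-toℕ K))
      (maximal _ (increasing⇒feasible incr))

  exchange : ∀ {I J u v} → (∀ x → ((x ∈ I × x ∉ J) ⇔ (x ≡ u))) → (∀ x → ((x ∈ J × x ∉ I) ⇔ (x ≡ v))) →
             Exchange (indicator I) (indicator J) (toℕ u) (toℕ v)
  exchange {I} {J} {u} {v} I∖J≡u J∖I≡v = record
    { u∈I = trans (indicator-toℕ I u) ([]=⇒lookup (proj₁ u∈I∖J))
    ; u∉J = trans (indicator-toℕ J u) (∉⇒lookup≡false J (proj₂ u∈I∖J))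
    ; v∈J = trans (indicator-toℕ J v) ([]=⇒lookup (proj₁ v∈J∖I))
    ; v∉I = trans (indicator-toℕ I v) (∉⇒lookup≡false I (proj₂ v∈J∖I))
    ; agree = agree
    }
    where
    u∈I∖J : u ∈ I × u ∉ J
    u∈I∖J = Equivalence.from (I∖J≡u u) refl
    v∈J∖I : v ∈ J × v ∉ I
    v∈J∖I = Equivalence.from (J∖I≡v v) refl
    agree : ∀ {k} → k < suc n → k ≢ toℕ u → k ≢ toℕ v → indicator I k ≡ indicator J k
    agree {k} k<N k≢u k≢v with lookup I (clamp n k) in I-k | lookup J (clamp n k) in J-k
    ... | true | true = refl
    ... | false | false = refl
    ... | true | false = ⊥-elim (k≢u (trans (sym (toℕ-clamp n k<N))
          (cong toℕ (Equivalence.to (I∖J≡u _) (lookup⇒[]= _ I I-k , lookup≡false⇒∉ J J-k)))))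
    ... | false | true = ⊥-elim (k≢v (trans (sym (toℕ-clamp n k<N))
          (cong toℕ (Equivalence.to (J∖I≡v _) (lookup⇒[]= _ J J-k , lookup≡false⇒∉ I I-k)))))

  piles≡state : piles a ≡ state (suc n)
  piles≡state = trans (cong patience (map-toList-tabulate (suc n) (λ i → i) a b (cong a ∘ sym ∘ clamp-toℕ n)))
                      (patience-applyUpTo (suc n))

  commonPile : ∀ {u v} → pile (toℕ u) ≡ pile (toℕ v) → ∃[ P ] (P ∈ₗ piles a × a u ∈ₗ P × a v ∈ₗ P)
  commonPile {u} {v} pu≡pv with commonPile-state (toℕ<n u) (toℕ<n v) pu≡pv
  ... | P , P∈ , au∈ , av∈ =
    P , subst (P ∈ₗ_) (sym piles≡state) P∈ ,
    subst (_∈ₗ P) (cong a (clamp-toℕ n u)) au∈ , subst (_∈ₗ P) (cong a (clamp-toℕ n v)) av∈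

mainTheorem5 : (n : ℕ) (a : Fin (suc n) → ℕ)
    → a zero ≡ 0
    → (∀ (i : Fin n) → 1 ≤ a (suc i) × a (suc i) ≤ n)
    → Injective _≡_ _≡_ a
    → (I J : Subset (suc n)) (u v : Fin (suc n))
    → MaxFeasible a I → MaxFeasible a J
    → (∀ x → ((x ∈ I × x ∉ J) ⇔ (x ≡ u)))
    → (∀ x → ((x ∈ J × x ∉ I) ⇔ (x ≡ v)))
    → ∃[ P ] (P ∈ₗ piles a × a u ∈ₗ P × a v ∈ₗ P)
mainTheorem5 n a _ _ a-inj I J u v maxI maxJ I∖J≡u J∖I≡v =
  commonPile (exchange-pile≡ (distinct a-inj) (maxFeasible⇒maximum maxI) (maxFeasible⇒maximum maxJ)
                                (exchange I∖J≡u J∖I≡v) (toℕ<n u) (toℕ<n v))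
  where open OnFin n a
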